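{- For every integer $n \ge 1$, let $\Pi_n$ be the set of integer arrays $\pi$ of length $n$ such that $\pi = \pi_x$ for some binary word $x \in \{0,1\}^n$, and let $T_n = |\Pi_n|$. Then $T_n = 2^{n-1}$.
   Context: For a binary word $w$ over $\{0,1\}$, $ones(w)$ denotes the number of $1$'s in $w$. Two binary words of equal length are abelian equivalent if they have the same number of $1$'s. An abelian border of a binary word $w$ is a proper prefix of $w$ (i.e. a prefix different from $w$, possibly empty) that is abelian equivalent to the proper suffix of $w$ of the same length. For a binary word $x$ of length $n$ and $1 \le i \le n$, $x[1\cdots i]$ is its prefix of length $i$, and the abelian border array $\pi_x$ is the array of length $n$ with $\pi_x[i]$ equal to the length of the longest abelian border of $x[1\cdots i]$. -}

module Defs where

open import Data.Bool using (Bool; true; false; if_then_else_)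
open import Data.Nat using (ℕ; zero; suc; _+_; _∸_; _≡ᵇ_)

open import Data.List using (List; []; _∷_; length; take; drop)
open import Data.Vec using (Vec; tabulate; toList)
open import Data.Fin using (Fin; toℕ)

ones : List Bool → ℕ
ones [] = 0
ones (true ∷ w) = suc (ones w)
ones (false ∷ w) = ones w

-- the prefix of length l of w is abelian equivalent to the suffix of length l
abBorderᵇ : List Bool → ℕ → Bool
abBorderᵇ w l = ones (take l w) ≡ᵇ ones (drop (length w ∸ l) w)

longestBelow : List Bool → ℕ → ℕ
longestBelow w zero = 0
longestBelow w (suc k) = if abBorderᵇ w k then k else longestBelow w k

-- length of the longest abelian border (proper: length < |w|) of w
longestAbBorder : List Bool → ℕ
longestAbBorder w = longestBelow w (length w)

-- abelian border array: π x [i] (1-based i) = longest abelian border of x[1..i]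
abBorderArray : {n : ℕ} → Vec Bool n → Vec ℕ n
abBorderArray x = tabulate (λ i → longestAbBorder (take (suc (toℕ i)) (toList x)))

-- For i ≥ 2 the longest abelian border of x[1..i] has length i − 1 exactly when
-- x[1] = x[i]: the prefix x[1..i−1] and the suffix x[2..i] share x[2..i−1].
-- Hence π_x determines x up to complementing every letter, and complementing
-- leaves π_x unchanged, since it only swaps the counts of 0's and 1's in two
-- words of the same length. So Π_n is in bijection with the 2^(n−1) words
-- starting with 0.
module Submission where

open import Defs
open import Data.Bool using (Bool; true; false; not; T)
import Data.Bool.Properties as Bool
open import Data.Nat using (ℕ; zero; suc; _+_; _∸_; _^_; _⊓_; _≤_; s≤s; _≡ᵇ_)
open import Data.Nat.Properties
open import Data.Fin using (Fin; toℕ; zero; suc)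
open import Data.List
  using (List; []; _∷_; [_]; _++_; _∷ʳ_; length; take; drop; map)
open import Data.List.Properties using (length-map; length-++; length-take; length-drop; take-map; drop-map)
open import Data.List.Membership.Propositional using (_∈_)
open import Data.List.Membership.Propositional.Properties using (∈-map⁺; ∈-map⁻; ∈-++⁺ˡ; ∈-++⁺ʳ)
open import Data.List.Relation.Unary.Any using (here)
open import Data.List.Relation.Unary.All using ([])
open import Data.List.Relation.Unary.AllPairs using ([]; _∷_)
open import Data.List.Relation.Unary.Unique.Propositional using (Unique)
import Data.List.Relation.Unary.Unique.Propositional.Properties as Unique
open import Data.Vec using (Vec; []; _∷_; lookup; toList)
import Data.Vec as Vec
open import Data.Vec.Properties using (lookup∘tabulate; tabulate-cong; tabulate∘lookup; toList-map; ∷-injectiveʳ)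
open import Data.Product using (Σ; ∃; _×_; _,_)
open import Function using (_∘_)
open import Function.Bundles using (_⇔_; mk⇔; Equivalence)
open import Function.Properties.Equivalence using () renaming (sym to ⇔-sym; trans to ⇔-trans)
open import Relation.Nullary using (¬_; yes; no; contradiction)
open import Relation.Nullary.Decidable using (does-⇔)
open import Relation.Binary.PropositionalEquality using (_≡_; refl; sym; trans; cong; cong₂; subst; module ≡-Reasoning)

open Equivalence using (to; from)

≡-⇔-cancelˡ : ∀ {a b c : Bool} → (a ≡ b ⇔ a ≡ c) → b ≡ c
≡-⇔-cancelˡ {a} {b} {c} a≡b⇔a≡c with a Bool.≟ b | a Bool.≟ c
... | yes refl | yes refl = refl
... | yes a≡b  | no  a≢c  = contradiction (to a≡b⇔a≡c a≡b) a≢c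
... | no  a≢b  | yes a≡c  = contradiction (from a≡b⇔a≡c a≡c) a≢b
... | no  a≢b  | no  a≢c  = trans (Bool.¬-not (a≢b ∘ sym)) (sym (Bool.¬-not (a≢c ∘ sym)))

T-≡ᵇ⇔≡ : ∀ m n → T (m ≡ᵇ n) ⇔ m ≡ n
T-≡ᵇ⇔≡ m n = mk⇔ (≡ᵇ⇒≡ m n) (≡⇒≡ᵇ m n)

take-length-++ : ∀ {A : Set} (u v : List A) → take (length u) (u ++ v) ≡ u
take-length-++ []      v = refl
take-length-++ (x ∷ u) v = cong (x ∷_) (take-length-++ u v)

ones-∷ : ∀ c u → ones (c ∷ u) ≡ ones [ c ] + ones u
ones-∷ true  u = refl
ones-∷ false u = refl

ones-++ : ∀ u v → ones (u ++ v) ≡ ones u + ones v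
ones-++ []      v = refl
ones-++ (c ∷ u) v = begin
  ones (c ∷ u ++ v)          ≡⟨ ones-∷ c (u ++ v) ⟩
  ones [ c ] + ones (u ++ v) ≡⟨ cong (ones [ c ] +_) (ones-++ u v) ⟩
  ones [ c ] + (ones u + ones v) ≡⟨ sym (+-assoc (ones [ c ]) _ _) ⟩
  ones [ c ] + ones u + ones v ≡⟨ cong (_+ ones v) (sym (ones-∷ c u)) ⟩
  ones (c ∷ u) + ones v      ∎
  where open ≡-Reasoning

ones-∷ʳ : ∀ u c → ones (u ∷ʳ c) ≡ ones (c ∷ u)
ones-∷ʳ u c = begin
  ones (u ++ [ c ])    ≡⟨ ones-++ u [ c ] ⟩
  ones u + ones [ c ]  ≡⟨ +-comm (ones u) (ones [ c ]) ⟩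
  ones [ c ] + ones u  ≡⟨ sym (ones-∷ c u) ⟩
  ones (c ∷ u)         ∎
  where open ≡-Reasoning

ones-∷-injective : ∀ a c u → ones (a ∷ u) ≡ ones (c ∷ u) → a ≡ c
ones-∷-injective true  true  u _ = refl
ones-∷-injective false false u _ = refl
ones-∷-injective true  false u e = contradiction e 1+n≢n
ones-∷-injective false true  u e = contradiction (sym e) 1+n≢n

ones-map-not : ∀ u → ones (map not u) + ones u ≡ length u
ones-map-not []          = refl
ones-map-not (true ∷ u)  = trans (+-suc _ _) (cong suc (ones-map-not u))
ones-map-not (false ∷ u) = cong suc (ones-map-not u)

ones-map-not-≡⇔ : ∀ u v → length u ≡ length v →
                  ones (map not u) ≡ ones (map not v) ⇔ ones u ≡ ones v
ones-map-not-≡⇔ u v |u|≡|v| = mk⇔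
  (λ e → +-cancelˡ-≡ (ones (map not u)) _ _
           (trans total (cong (_+ ones v) (sym e))))
  (λ e → +-cancelʳ-≡ (ones u) _ _
           (trans total (cong (ones (map not v) +_) (sym e))))
  where
  total : ones (map not u) + ones u ≡ ones (map not v) + ones v
  total = trans (ones-map-not u) (trans |u|≡|v| (sym (ones-map-not v)))

abBorderᵇ-map-not : ∀ w l → l ≤ length w → abBorderᵇ (map not w) l ≡ abBorderᵇ w l
abBorderᵇ-map-not w l l≤|w|
  rewrite length-map not w | take-map {f = not} l w | drop-map {f = not} (length w ∸ l) w
  -- ℕ's _≟_ is built from _≡ᵇ_, so abBorderᵇ w l is definitionally does (_ ≟ _).
  = does-⇔ (ones-map-not-≡⇔ prefix suffix |prefix|≡|suffix|) (_ ≟ _) (_ ≟ _)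
  where
  prefix suffix : List Bool
  prefix = take l w
  suffix = drop (length w ∸ l) w
  |prefix|≡|suffix| : length prefix ≡ length suffix
  |prefix|≡|suffix| = begin
    length prefix              ≡⟨ length-take l w ⟩
    l ⊓ length w               ≡⟨ m≤n⇒m⊓n≡m l≤|w| ⟩
    l                          ≡⟨ sym (m∸[m∸n]≡n l≤|w|) ⟩
    length w ∸ (length w ∸ l)  ≡⟨ sym (length-drop (length w ∸ l) w) ⟩
    length suffix              ∎
    where open ≡-Reasoning

longestBelow-map-not : ∀ w k → k ≤ length w → longestBelow (map not w) k ≡ longestBelow w k
longestBelow-map-not w zero    _ = refl
longestBelow-map-not w (suc k) k<|w|
  rewrite abBorderᵇ-map-not w k (<⇒≤ k<|w|) | longestBelow-map-not w k (<⇒≤ k<|w|) = refl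

longestAbBorder-map-not : ∀ w → longestAbBorder (map not w) ≡ longestAbBorder w
longestAbBorder-map-not w rewrite length-map not w = longestBelow-map-not w (length w) ≤-refl

abBorderArray-map-not : ∀ {n} (x : Vec Bool n) → abBorderArray (Vec.map not x) ≡ abBorderArray x
abBorderArray-map-not x = tabulate-cong λ i → begin
  longestAbBorder (take (suc (toℕ i)) (toList (Vec.map not x)))
    ≡⟨ cong (longestAbBorder ∘ take (suc (toℕ i))) (toList-map not x) ⟩
  longestAbBorder (take (suc (toℕ i)) (map not (toList x)))
    ≡⟨ cong longestAbBorder (take-map {f = not} (suc (toℕ i)) (toList x)) ⟩
  longestAbBorder (map not (take (suc (toℕ i)) (toList x)))
    ≡⟨ longestAbBorder-map-not (take (suc (toℕ i)) (toList x)) ⟩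
  longestAbBorder (take (suc (toℕ i)) (toList x)) ∎
  where open ≡-Reasoning

longestBelow-suc-≤ : ∀ w k → longestBelow w (suc k) ≤ k
longestBelow-suc-≤ w zero    with abBorderᵇ w zero
... | true  = ≤-refl
... | false = ≤-refl
longestBelow-suc-≤ w (suc k) with abBorderᵇ w (suc k)
... | true  = ≤-refl
... | false = m≤n⇒m≤1+n (longestBelow-suc-≤ w k)

longestBelow≡⇔abBorder : ∀ w k → longestBelow w (suc (suc k)) ≡ suc k ⇔ T (abBorderᵇ w (suc k))
longestBelow≡⇔abBorder w k with abBorderᵇ w (suc k)
... | true  = mk⇔ _ (λ _ → refl)
... | false = mk⇔ (λ e → contradiction e (<⇒≢ (s≤s (longestBelow-suc-≤ w k)))) λ ()

abBorderᵇ-drop-last⇔ : ∀ a c q → T (abBorderᵇ (a ∷ (q ∷ʳ c)) (suc (length q))) ⇔ a ≡ c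
abBorderᵇ-drop-last⇔ a c q
  rewrite take-length-++ q [ c ] | length-++ q {[ c ]} | m+n∸m≡n (length q) 1
        | ones-∷ʳ q c
  = mk⇔ (ones-∷-injective a c q ∘ to (T-≡ᵇ⇔≡ _ _))
        (from (T-≡ᵇ⇔≡ _ _) ∘ cong (λ b → ones (b ∷ q)))

longestAbBorder≡⇔ : ∀ a c q → longestAbBorder (a ∷ (q ∷ʳ c)) ≡ suc (length q) ⇔ a ≡ c
longestAbBorder≡⇔ a c q =
  subst (λ m → longestBelow w m ≡ suc (length q) ⇔ a ≡ c) (sym |w|≡2+|q|)
    (⇔-trans (longestBelow≡⇔abBorder w (length q)) (abBorderᵇ-drop-last⇔ a c q))
  where
  w : List Bool
  w = a ∷ (q ∷ʳ c)
  |w|≡2+|q| : length w ≡ suc (suc (length q))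
  |w|≡2+|q| = cong suc (trans (length-++ q) (+-comm (length q) 1))

take-suc-toList : ∀ {A : Set} {n} (x : Vec A n) (i : Fin n) →
                  take (suc (toℕ i)) (toList x) ≡ take (toℕ i) (toList x) ∷ʳ lookup x i
take-suc-toList (a ∷ x) zero    = refl
take-suc-toList (a ∷ x) (suc i) = cong (a ∷_) (take-suc-toList x i)

length-take-toList : ∀ {A : Set} {n} (x : Vec A n) (i : Fin n) →
                     length (take (toℕ i) (toList x)) ≡ toℕ i
length-take-toList (a ∷ x) zero    = refl
length-take-toList (a ∷ x) (suc i) = cong suc (length-take-toList x i)

lookup-abBorderArray-suc⇔ : ∀ {n} a (x : Vec Bool n) (i : Fin n) →
  lookup (abBorderArray (a ∷ x)) (suc i) ≡ suc (toℕ i) ⇔ a ≡ lookup x i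
lookup-abBorderArray-suc⇔ a x i =
  subst (λ v → v ≡ suc (toℕ i) ⇔ a ≡ lookup x i) (sym entry)
    (subst (λ m → longestAbBorder (a ∷ (q ∷ʳ lookup x i)) ≡ suc m ⇔ a ≡ lookup x i)
      (length-take-toList x i)
      (longestAbBorder≡⇔ a (lookup x i) q))
  where
  q : List Bool
  q = take (toℕ i) (toList x)
  entry : lookup (abBorderArray (a ∷ x)) (suc i) ≡ longestAbBorder (a ∷ (q ∷ʳ lookup x i))
  entry = trans (lookup∘tabulate (λ j → longestAbBorder (take (suc (toℕ j)) (toList (a ∷ x)))) (suc i)) (cong (longestAbBorder ∘ (a ∷_)) (take-suc-toList x i))

abBorderArray-∷-injective : ∀ {n} a (x y : Vec Bool n) →
                            abBorderArray (a ∷ x) ≡ abBorderArray (a ∷ y) → x ≡ y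
abBorderArray-∷-injective a x y πx≡πy = begin
  x                      ≡⟨ tabulate∘lookup x ⟨
  Vec.tabulate (lookup x) ≡⟨ tabulate-cong lookup-≡ ⟩
  Vec.tabulate (lookup y) ≡⟨ tabulate∘lookup y ⟩
  y                      ∎
  where
  open ≡-Reasoning
  lookup-≡ : ∀ i → lookup x i ≡ lookup y i
  lookup-≡ i = ≡-⇔-cancelˡ (⇔-trans (⇔-sym (lookup-abBorderArray-suc⇔ a x i))
                 (subst (λ π → lookup π (suc i) ≡ suc (toℕ i) ⇔ a ≡ lookup y i) (sym πx≡πy)
                   (lookup-abBorderArray-suc⇔ a y i)))

normalise-abBorderArray : ∀ {m} (x : Vec Bool (suc m)) →
                          ∃ λ (v : Vec Bool m) → abBorderArray (false ∷ v) ≡ abBorderArray x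
normalise-abBorderArray (false ∷ v) = v , refl
normalise-abBorderArray (true ∷ v)  = Vec.map not v , abBorderArray-map-not (true ∷ v)

allVecs : ∀ m → List (Vec Bool m)
allVecs zero    = [ [] ]
allVecs (suc m) = map (true ∷_) (allVecs m) ++ map (false ∷_) (allVecs m)

length-allVecs : ∀ m → length (allVecs m) ≡ 2 ^ m
length-allVecs zero    = refl
length-allVecs (suc m) = begin
  length (map (true ∷_) (allVecs m) ++ map (false ∷_) (allVecs m))
    ≡⟨ length-++ (map (true ∷_) (allVecs m)) ⟩
  length (map (true ∷_) (allVecs m)) + length (map (false ∷_) (allVecs m))
    ≡⟨ cong₂ _+_ (length-map (true ∷_) (allVecs m)) (length-map (false ∷_) (allVecs m)) ⟩
  length (allVecs m) + length (allVecs m)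
    ≡⟨ cong₂ _+_ (length-allVecs m) (trans (length-allVecs m) (sym (+-identityʳ (2 ^ m)))) ⟩
  2 ^ suc m
    ∎
  where open ≡-Reasoning

∈-allVecs : ∀ {m} (v : Vec Bool m) → v ∈ allVecs m
∈-allVecs []                = here refl
∈-allVecs {suc m} (true ∷ v)  = ∈-++⁺ˡ (∈-map⁺ (true ∷_) (∈-allVecs v))
∈-allVecs {suc m} (false ∷ v) = ∈-++⁺ʳ (map (true ∷_) (allVecs m)) (∈-map⁺ (false ∷_) (∈-allVecs v))

allVecs-unique : ∀ m → Unique (allVecs m)
allVecs-unique zero    = [] ∷ []
allVecs-unique (suc m) =
  Unique.++⁺ (Unique.map⁺ ∷-injectiveʳ (allVecs-unique m))
             (Unique.map⁺ ∷-injectiveʳ (allVecs-unique m))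
             disjoint
  where
  disjoint : ∀ {v} → ¬ (v ∈ map (true ∷_) (allVecs m) × v ∈ map (false ∷_) (allVecs m))
  disjoint (p , q) with ∈-map⁻ (true ∷_) p | ∈-map⁻ (false ∷_) q
  ... | _ , _ , refl | _ , _ , ()

mainTheorem1 : (n : ℕ) → 1 ≤ n →
    Σ (List (Vec ℕ n)) (λ Πn →
      Unique Πn ×
      ((a : Vec ℕ n) → (a ∈ Πn) ⇔ (∃ λ (x : Vec Bool n) → abBorderArray x ≡ a)) ×
      length Πn ≡ 2 ^ (n ∸ 1))
mainTheorem1 (suc m) _ =
  map π₀ (allVecs m) ,
  Unique.map⁺ (abBorderArray-∷-injective false _ _) (allVecs-unique m) ,
  (λ a → mk⇔ (image a) (preimage a)) ,
  trans (length-map π₀ (allVecs m)) (length-allVecs m)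
  where
  π₀ : Vec Bool m → Vec ℕ (suc m)
  π₀ v = abBorderArray (false ∷ v)
  image : ∀ a → a ∈ map π₀ (allVecs m) → ∃ λ (x : Vec Bool (suc m)) → abBorderArray x ≡ a
  image a a∈ with ∈-map⁻ π₀ a∈
  ... | v , _ , a≡π₀v = false ∷ v , sym a≡π₀v
  preimage : ∀ a → (∃ λ (x : Vec Bool (suc m)) → abBorderArray x ≡ a) → a ∈ map π₀ (allVecs m)
  preimage a (x , πx≡a) with normalise-abBorderArray x
  ... | v , π₀v≡πx = subst (_∈ map π₀ (allVecs m)) (trans π₀v≡πx πx≡a) (∈-map⁺ π₀ (∈-allVecs v))
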